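{- Let $\mathbf{a}=(a_1,a_2,\ldots)$ and $\mathbf{e}=(e_1,e_2,\ldots)$ be arbitrary real sequences (both infinite, or both of length $n$, in which case the network is truncated to rows $0,\ldots,n$). Consider the weighted network described in the context with weights $x_{mk}=a_k-e_{m-k+1}$ for all $m\ge k\ge 1$. Then its path matrix equals $S^{\mathbf{a},\mathbf{e}}$.
   Context: The network: for each integer $i\ge0$ there is a source $s_i$, a sink $t_i$, and vertices $v(i,1),\ldots,v(i,i+1)$; horizontal directed edges $s_i\to v(i,1)\to v(i,2)\to\cdots\to v(i,i+1)\to t_i$, all of weight $1$; and for each $m\ge k\ge1$ a vertical directed edge (the $[m,k]$ edge) $v(m,k)\to v(m-1,k)$ of weight $x_{mk}$. This is a planar directed network (horizontal lines drawn top to bottom in order $i=0,1,2,\ldots$, oriented rightward; vertical columns oriented upward). The path matrix is the matrix indexed by $\{0,1,2,\ldots\}$ whose $(i,j)$ entry is the sum, over all directed paths from $s_i$ to $t_j$, of the product of the edge weights along the path. The matrix $S^{\mathbf{a},\mathbf{e}}$ has entries defined by $\prod_{i=1}^m(x-e_i)=\sum_{k=0}^m S^{\mathbf{a},\mathbf{e}}(m,k)\prod_{i=1}^k(x-a_i)$ for $m\ge0$, with $S^{\mathbf{a},\mathbf{e}}(m,k)=0$ for $k>m$. -}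

module Defs where

open import Level using (Level)
open import Data.Nat using (ℕ; zero; suc; _∸_; _≟_)
open import Data.List using (List; []; _∷_; _++_; map; foldr)
open import Relation.Nullary using (yes; no)
open import Relation.Binary.PropositionalEquality using (refl)
open import Algebra.Bundles using (CommutativeRing)

-- Vertices v(m,k) (1 ≤ k ≤ m+1) are addressed here by the pair (m, r)
-- with r = m + 1 - k ("number of columns left before the sink t_m");
-- so v(m,k) = (m, m+1-k), the first vertex v(i,1) of row i is (i, i),
-- and the last vertex v(m,m+1) is (m, 0).
-- Out-edges of v(m,k):
--   * k ≤ m   : horizontal edge v(m,k) → v(m,k+1)   i.e. (m, suc r) → (m, r)      weight 1
--   * k = m+1 : horizontal edge v(m,m+1) → t_m      i.e. (m, 0) → t_m             weight 1
--   * m ≥ k ≥ 1 : vertical [m,k] edge v(m,k) → v(m-1,k)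
--               i.e. (suc m', suc r) → (m', r)   (column k = suc m' ∸ r)          weight x_{mk}
-- Path m r j  =  directed paths from vertex (m, r) to the sink t_j.

data Path : ℕ → ℕ → ℕ → Set where
  exit  : ∀ {m} → Path m 0 m
  right : ∀ {m r j} → Path m r j → Path m (suc r) j
  up    : ∀ {m r j} → Path m r j → Path (suc m) (suc r) j

paths : (m r j : ℕ) → List (Path m r j)
paths m zero j with m ≟ j
... | yes refl = exit ∷ []
... | no _     = []
paths m (suc r) j = map right (paths m r j) ++ upPaths m
  where
  upPaths : (m : ℕ) → List (Path m (suc r) j)
  upPaths zero     = []
  upPaths (suc m') = map up (paths m' r j)

module _ {c ℓ : Level} (R : CommutativeRing c ℓ) where
  open CommutativeRing R

  -- Weight of the [m,k] edge: x_{mk} = a_k - e_{m-k+1}.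
  -- Sequences are functions ℕ → Carrier; only indices ≥ 1 are used.
  edgeWeight : (a e : ℕ → Carrier) (m k : ℕ) → Carrier
  edgeWeight a e m k = a k - e (suc (m ∸ k))

  pathWeight : (a e : ℕ → Carrier) {m r j : ℕ} → Path m r j → Carrier
  pathWeight a e exit      = 1#
  pathWeight a e (right p) = 1# * pathWeight a e p
  pathWeight a e (up {m} {r} p) = edgeWeight a e (suc m) (suc m ∸ r) * pathWeight a e p

  sumList : List Carrier → Carrier
  sumList = foldr _+_ 0#

  -- Path matrix: (i,j) entry = sum over paths s_i → t_j of path weights.
  -- The edge s_i → v(i,1) has weight 1; v(i,1) is the vertex (i, i).
  pathMatrix : (a e : ℕ → Carrier) (i j : ℕ) → Carrier
  pathMatrix a e i j = 1# * sumList (map (pathWeight a e) (paths i i j))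

  prod1 : ℕ → (ℕ → Carrier) → Carrier
  prod1 zero    f = 1#
  prod1 (suc m) f = prod1 m f * f (suc m)

  sum0 : ℕ → (ℕ → Carrier) → Carrier
  sum0 zero    f = f 0
  sum0 (suc m) f = sum0 m f + f (suc m)

module Submission where

-- For a vertex (m , r) of the network (see Defs) let  flow m r j  be
-- the total weight of the paths from it to the sink t_j, so that the path matrix
-- entry (i , j) is  1 * flow i i j.  Sorting paths by their first edge gives
--   flow m 0 j = [m = j],   flow 0 (r+1) j = flow 0 r j,
--   flow (m+1) (r+1) j = flow (m+1) r j + x · flow m r j   (x the vertical edge).
-- Every edge goes right or up, so  flow m r j = 0  whenever m < j: the path matrix
-- is lower triangular, which is the first half of the theorem.
-- For the second half fix x, put  A k = ∏_{i≤k} (x - a_i),  E r = ∏_{i≤r} (x - e_i),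
-- and pair the flows of a vertex with the basis A:  G m r = Σ_{j≤m} flow m r j · A j.
-- The key invariant is  G (r + k) r = A k · E r :  the vertex v(r+k, k+1) "produces"
-- A k · E r.  For r = 0 the only path from (k , 0) is the exit to t_k; the recurrence
-- for flows becomes  G (n+1) (r+1) = G (n+1) r + x · G n r,  and the weight of the
-- vertical edge at the vertex (r+k+1 , r+1) is  a_{k+1} - e_{r+1},  which makes
--   A (k+1) · E r + (a_{k+1} - e_{r+1}) · A k · E r = A k · E (r+1)
-- telescope.  Taking k = 0 and r = m yields  E m = Σ_k S(m,k) · A k.

open import Defs
open import Data.Nat as ℕ using (ℕ; zero; suc; _∸_; _≟_; _≤_; _<_; s≤s)
open import Data.Nat.Properties
  using (+-suc; m+n∸n≡m; m+n∸m≡n; <⇒≤; <⇒≢; n<1+n; ≤-refl; m≤n⇒m≤1+n)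
import Data.Nat.Properties as ℕₚ
open import Data.Product using (_×_; _,_)
open import Data.List using (List; []; _∷_; _++_; map)
open import Level using (Level)
open import Algebra.Bundles using (CommutativeRing)
open import Relation.Nullary using (yes; no)
open import Data.Empty using (⊥-elim)
open import Relation.Binary.PropositionalEquality as P using (_≡_; _≢_)
import Algebra.Properties.CommutativeSemigroup as CommSemigroupProperties
import Relation.Binary.Reasoning.Setoid as SetoidReasoning

module _ {c ℓ : Level} (R : CommutativeRing c ℓ) where
  open CommutativeRing R hiding (zero)
  open SetoidReasoning setoid

  telescope : ∀ u v w → (u - v) + (v - w) ≈ u - w
  telescope u v w = begin
      (u + - v) + (v + - w)   ≈⟨ +-assoc _ _ _ ⟩
      u + (- v + (v + - w))   ≈⟨ +-congˡ (sym (+-assoc _ _ _)) ⟩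
      u + ((- v + v) + - w)   ≈⟨ +-congˡ (+-congʳ (-‿inverseˡ v)) ⟩
      u + (0# + - w)          ≈⟨ +-congˡ (+-identityˡ _) ⟩
      u + - w                 ∎

  sum0-cong : ∀ n {f g : ℕ → Carrier} → (∀ i → f i ≈ g i) → sum0 R n f ≈ sum0 R n g
  sum0-cong zero    f≈g = f≈g 0
  sum0-cong (suc n) f≈g = +-cong (sum0-cong n f≈g) (f≈g (suc n))

  sum0-+ : ∀ n (f g : ℕ → Carrier) → sum0 R n (λ i → f i + g i) ≈ sum0 R n f + sum0 R n g
  sum0-+ zero    f g = refl
  sum0-+ (suc n) f g =
    trans (+-congʳ (sum0-+ n f g)) (CommSemigroupProperties.interchange +-commutativeSemigroup _ _ _ _)

  sum0-*ˡ : ∀ n (w : Carrier) (f : ℕ → Carrier) → sum0 R n (λ i → w * f i) ≈ w * sum0 R n f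
  sum0-*ˡ zero    w f = refl
  sum0-*ˡ (suc n) w f = trans (+-congʳ (sum0-*ˡ n w f)) (sym (distribˡ _ _ _))

  sum0-zero : ∀ n (f : ℕ → Carrier) → (∀ i → i ≤ n → f i ≈ 0#) → sum0 R n f ≈ 0#
  sum0-zero zero    f f≈0 = f≈0 0 ≤-refl
  sum0-zero (suc n) f f≈0 =
    trans (+-cong (sum0-zero n f (λ i i≤n → f≈0 i (m≤n⇒m≤1+n i≤n))) (f≈0 (suc n) ≤-refl))
          (+-identityˡ 0#)

  sum0-last : ∀ n (f : ℕ → Carrier) → (∀ i → i < n → f i ≈ 0#) → sum0 R n f ≈ f n
  sum0-last zero    f f≈0 = refl
  sum0-last (suc n) f f≈0 =
    trans (+-congʳ (sum0-zero n f (λ i i≤n → f≈0 i (s≤s i≤n)))) (+-identityˡ _)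

  module Network (a e : ℕ → Carrier) where

    total : ∀ {m r j} → List (Path m r j) → Carrier
    total ps = sumList R (map (pathWeight R a e) ps)

    flow : ℕ → ℕ → ℕ → Carrier
    flow m r j = total (paths m r j)

    total-++ : ∀ {m r j} (ps qs : List (Path m r j)) → total (ps ++ qs) ≈ total ps + total qs
    total-++ []       qs = sym (+-identityˡ _)
    total-++ (p ∷ ps) qs = trans (+-congˡ (total-++ ps qs)) (sym (+-assoc _ _ _))

    total-right : ∀ {m r j} (ps : List (Path m r j)) → total (map right ps) ≈ total ps
    total-right []       = refl
    total-right (p ∷ ps) = +-cong (*-identityˡ _) (total-right ps)

    total-up : ∀ {m r j} (ps : List (Path m r j)) →
      total (map up ps) ≈ edgeWeight R a e (suc m) (suc m ∸ r) * total ps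
    total-up []       = sym (zeroʳ _)
    total-up (p ∷ ps) = trans (+-congˡ (total-up ps)) (sym (distribˡ _ _ _))

    flow-exit : ∀ m → flow m 0 m ≈ 1#
    flow-exit m with m ≟ m
    ... | yes P.refl = +-identityʳ _
    ... | no m≢m     = ⊥-elim (m≢m P.refl)

    flow-exit-≢ : ∀ m j → m ≢ j → flow m 0 j ≈ 0#
    flow-exit-≢ m j m≢j with m ≟ j
    ... | yes m≡j = ⊥-elim (m≢j m≡j)
    ... | no _    = refl

    flow-top : ∀ r j → flow 0 (suc r) j ≈ flow 0 r j
    flow-top r j = begin
      total (map right (paths 0 r j) ++ [])       ≈⟨ total-++ (map right (paths 0 r j)) [] ⟩
      total (map right (paths 0 r j)) + 0#        ≈⟨ +-identityʳ _ ⟩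
      total (map right (paths 0 r j))             ≈⟨ total-right (paths 0 r j) ⟩
      flow 0 r j                                  ∎

    flow-step : ∀ m r j →
      flow (suc m) (suc r) j ≈ flow (suc m) r j + edgeWeight R a e (suc m) (suc m ∸ r) * flow m r j
    flow-step m r j = begin
      total (map right (paths (suc m) r j) ++ map up (paths m r j))
        ≈⟨ total-++ (map right (paths (suc m) r j)) (map up (paths m r j)) ⟩
      total (map right (paths (suc m) r j)) + total (map up (paths m r j))
        ≈⟨ +-cong (total-right (paths (suc m) r j)) (total-up (paths m r j)) ⟩
      flow (suc m) r j + edgeWeight R a e (suc m) (suc m ∸ r) * flow m r j
        ∎

    -- Paths never go down, so no path from row m reaches t_j for j > m.
    flow-below : ∀ r m j → m < j → flow m r j ≈ 0#
    flow-below zero    m       j m<j = flow-exit-≢ m j (<⇒≢ m<j)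
    flow-below (suc r) zero    j m<j = trans (flow-top r j) (flow-below r zero j m<j)
    flow-below (suc r) (suc m) j m<j = begin
      flow (suc m) (suc r) j                       ≈⟨ flow-step m r j ⟩
      flow (suc m) r j + _ * flow m r j            ≈⟨ +-cong (flow-below r (suc m) j m<j)
                                                             (*-congˡ (flow-below r m j (<⇒≤ m<j))) ⟩
      0# + _ * 0#                                  ≈⟨ trans (+-identityˡ _) (zeroʳ _) ⟩
      0#                                           ∎

    vertical-weight : ∀ r k → edgeWeight R a e (suc (r ℕ.+ k)) (suc (r ℕ.+ k) ∸ r) ≡ a (suc k) - e (suc r)
    vertical-weight r k = P.trans (P.cong (edgeWeight R a e (suc (r ℕ.+ k))) column)
                                  (P.cong (λ i → a (suc k) - e (suc i)) (m+n∸n≡m r k))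
      where
      column : suc (r ℕ.+ k) ∸ r ≡ suc k
      column = P.trans (P.cong (_∸ r) (P.sym (+-suc r k))) (m+n∸m≡n r (suc k))

    module Expansion (x : Carrier) where

      A E : ℕ → Carrier
      A k = prod1 R k (λ i → x - a i)
      E r = prod1 R r (λ i → x - e i)

      G : ℕ → ℕ → Carrier
      G m r = sum0 R m (λ j → flow m r j * A j)

      -- The flow recurrence, paired with A; the extra term j = n+1 of the
      -- row-n sum vanishes by flow-below.
      G-step : ∀ n r →
        G (suc n) (suc r) ≈ G (suc n) r + edgeWeight R a e (suc n) (suc n ∸ r) * G n r
      G-step n r = begin
        G (suc n) (suc r)
          ≈⟨ sum0-cong (suc n) (λ j → trans (*-congʳ (flow-step n r j))
                                       (trans (distribʳ _ _ _) (+-congˡ (*-assoc _ _ _)))) ⟩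
        sum0 R (suc n) (λ j → flow (suc n) r j * A j + w * (flow n r j * A j))
          ≈⟨ sum0-+ (suc n) _ _ ⟩
        G (suc n) r + sum0 R (suc n) (λ j → w * (flow n r j * A j))
          ≈⟨ +-congˡ (sum0-*ˡ (suc n) w _) ⟩
        G (suc n) r + w * (G n r + flow n r (suc n) * A (suc n))
          ≈⟨ +-congˡ (*-congˡ (+-congˡ (trans (*-congʳ (flow-below r n (suc n) (n<1+n n))) (zeroˡ _)))) ⟩
        G (suc n) r + w * (G n r + 0#)
          ≈⟨ +-congˡ (*-congˡ (+-identityʳ _)) ⟩
        G (suc n) r + w * G n r
          ∎
        where w = edgeWeight R a e (suc n) (suc n ∸ r)

      product-step : ∀ k r → A (suc k) * E r + (a (suc k) - e (suc r)) * (A k * E r) ≈ A k * E (suc r)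
      product-step k r = begin
        A k * (x - a (suc k)) * E r + (a (suc k) - e (suc r)) * (A k * E r)
          ≈⟨ +-cong (trans (*-assoc _ _ _) (trans (*-congˡ (*-comm _ _)) (sym (*-assoc _ _ _))))
                    (*-comm _ _) ⟩
        A k * E r * (x - a (suc k)) + A k * E r * (a (suc k) - e (suc r))
          ≈⟨ sym (distribˡ _ _ _) ⟩
        A k * E r * ((x - a (suc k)) + (a (suc k) - e (suc r)))
          ≈⟨ *-congˡ (telescope x (a (suc k)) (e (suc r))) ⟩
        A k * E r * (x - e (suc r))
          ≈⟨ *-assoc _ _ _ ⟩
        A k * E (suc r)
          ∎

      invariant : ∀ r k → G (r ℕ.+ k) r ≈ A k * E r
      invariant zero k = begin
        G k 0             ≈⟨ sum0-last k _ (λ j j<k → trans (*-congʳ (flow-exit-≢ k j (λ k≡j → <⇒≢ j<k (P.sym k≡j))))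
                                                         (zeroˡ _)) ⟩
        flow k 0 k * A k  ≈⟨ *-congʳ (flow-exit k) ⟩
        1# * A k          ≈⟨ *-comm _ _ ⟩
        A k * 1#          ∎
      invariant (suc r) k = begin
        G (suc (r ℕ.+ k)) (suc r)
          ≈⟨ G-step (r ℕ.+ k) r ⟩
        G (suc (r ℕ.+ k)) r + edgeWeight R a e (suc (r ℕ.+ k)) (suc (r ℕ.+ k) ∸ r) * G (r ℕ.+ k) r
          ≈⟨ +-cong (P.subst (λ n → G n r ≈ A (suc k) * E r) (+-suc r k) (invariant r (suc k)))
                    (*-cong (reflexive (vertical-weight r k)) (invariant r k)) ⟩
        A (suc k) * E r + (a (suc k) - e (suc r)) * (A k * E r)
          ≈⟨ product-step k r ⟩
        A k * E (suc r)
          ∎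

lemma3p5 : {c ℓ : Level} (R : CommutativeRing c ℓ) →
    let open CommutativeRing R in
    (a e : ℕ → Carrier) →
      ((m k : ℕ) → m < k → pathMatrix R a e m k ≈ 0#)
      ×
      ((m : ℕ) (x : Carrier) →
        prod1 R m (λ i → x - e i)
          ≈ sum0 R m (λ k → pathMatrix R a e m k * prod1 R k (λ i → x - a i)))
lemma3p5 R a e = lowerTriangular , expansion
  where
  open CommutativeRing R
  open Network R a e
  open SetoidReasoning setoid

  lowerTriangular : ∀ m k → m < k → pathMatrix R a e m k ≈ 0#
  lowerTriangular m k m<k = trans (*-identityˡ _) (flow-below m m k m<k)

  expansion : ∀ m x → Expansion.E x m ≈ sum0 R m (λ k → pathMatrix R a e m k * Expansion.A x k)
  expansion m x = sym (begin
    sum0 R m (λ k → pathMatrix R a e m k * A k)  ≈⟨ sum0-cong R m (λ k → *-congʳ (*-identityˡ _)) ⟩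
    G m m                                        ≈⟨ P.subst (λ n → G n m ≈ A 0 * E m) (ℕₚ.+-identityʳ m) (invariant m 0) ⟩
    1# * E m                                     ≈⟨ *-identityˡ _ ⟩
    E m                                          ∎)
    where open Expansion x
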